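{- Let $k\in\mathbb N$, let $\Sigma_1,\dots,\Sigma_k$ be finite sets, and let $\mathcal S\subseteq\Sigma_1\times\cdots\times\Sigma_k$. Let $(G,\sigma_1,\dots,\sigma_k)$ be an Abelian embedding of $\mathcal S$, and let $j\in[k]$ be such that $\mathcal S$ is connected with respect to coordinate $j$. Then $\sigma_j$ is constant. In particular, if $\mathcal S$ is coordinate-wise connected, then $\mathcal S$ has no-Abelian-embeddings.
   Context: An Abelian embedding of $\mathcal S$ is a tuple $(G,\sigma_1,\dots,\sigma_k)$ with $G$ an Abelian group and maps $\sigma_i:\Sigma_i\to G$ such that $\sum_{i=1}^k\sigma_i(a_i)=0_G$ for every $(a_1,\dots,a_k)\in\mathcal S$; it is non-trivial if not all $\sigma_i$ are constant, and $\mathcal S$ has no-Abelian-embeddings if it admits no non-trivial one. For $j\in[k]$, let $\mathcal H_j(\mathcal S)$ be the simple graph on vertex set $\Sigma_j$ in which $x_j\neq x_j'$ are adjacent iff there is $x_{ -j}\in\prod_{i\ne j}\Sigma_i$ with both $(x_j,x_{ -j})\in\mathcal S$ and $(x_j',x_{ -j})\in\mathcal S$. $\mathcal S$ is connected with respect to coordinate $j$ if $\mathcal H_j(\mathcal S)$ is connected, and coordinate-wise connected if this holds for every $j\in[k]$. -}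

module Defs where

open import Level using (Level; _⊔_) renaming (suc to lsuc)
open import Data.Nat using (ℕ; zero; suc)
open import Data.Fin using (Fin; zero; suc; _≟_)
open import Data.Product using (Σ; ∃; _×_; _,_)
open import Relation.Binary.PropositionalEquality using (_≡_)
open import Relation.Nullary using (¬_; yes; no)
open import Function.Bundles using (_↔_)
open import Algebra.Bundles using (AbelianGroup)

Finite : ∀ {a} → Set a → Set a
Finite A = ∃ λ n → Fin n ↔ A

Tuple : ∀ {a} {k : ℕ} → (Fin k → Set a) → Set a
Tuple {k = k} Sig = (i : Fin k) → Sig i

module _ {c ℓ} (G : AbelianGroup c ℓ) where
  open AbelianGroup G renaming (Carrier to ∣G∣)

  ∑ : (k : ℕ) → (Fin k → ∣G∣) → ∣G∣
  ∑ zero    f = ε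
  ∑ (suc k) f = f zero ∙ ∑ k (λ i → f (suc i))

  IsAbelianEmbedding : ∀ {a p} {k : ℕ} {Sig : Fin k → Set a}
    → (Tuple Sig → Set p) → ((i : Fin k) → Sig i → ∣G∣) → Set (a ⊔ p ⊔ ℓ)
  IsAbelianEmbedding {k = k} S σ = ∀ x → S x → ∑ k (λ i → σ i (x i)) ≈ ε

  Constant : ∀ {a} {A : Set a} → (A → ∣G∣) → Set (a ⊔ ℓ)
  Constant f = ∀ x y → f x ≈ f y

update : ∀ {a} {k : ℕ} {Sig : Fin k → Set a}
  → Tuple Sig → (j : Fin k) → Sig j → Tuple Sig
update x j v i with j ≟ i
... | yes _≡_.refl = v
... | no _ = x i

-- Adjacency in H_j(S): x ≠ x' and some x_{-j} completes both into S.
-- x_{-j} is represented as a full tuple y whose j-th entry is ignored.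
Adj : ∀ {a p} {k : ℕ} {Sig : Fin k → Set a}
  → (Tuple Sig → Set p) → (j : Fin k) → Sig j → Sig j → Set (a ⊔ p)
Adj {Sig = Sig} S j v v' =
  ¬ (v ≡ v') × Σ (Tuple Sig) (λ y → S (update y j v) × S (update y j v'))

data Path {a r} {A : Set a} (R : A → A → Set r) : A → A → Set (a ⊔ r) where
  here : ∀ {x} → Path R x x
  step : ∀ {x y z} → R x y → Path R y z → Path R x z

Connected : ∀ {a r} {A : Set a} → (A → A → Set r) → Set (a ⊔ r)
Connected {A = A} R = (x y : A) → Path R x y

ConnectedWrt : ∀ {a p} {k : ℕ} {Sig : Fin k → Set a}
  → (Tuple Sig → Set p) → Fin k → Set (a ⊔ p)
ConnectedWrt S j = Connected (Adj S j)

CoordinatewiseConnected : ∀ {a p} {k : ℕ} {Sig : Fin k → Set a}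
  → (Tuple Sig → Set p) → Set (a ⊔ p)
CoordinatewiseConnected {k = k} S = (j : Fin k) → ConnectedWrt S j

NoAbelianEmbeddings : ∀ {a p} (c ℓ : Level) {k : ℕ} {Sig : Fin k → Set a}
  → (Tuple Sig → Set p) → Set (a ⊔ p ⊔ lsuc (c ⊔ ℓ))
NoAbelianEmbeddings c ℓ {k} {Sig} S =
  (G : AbelianGroup c ℓ) (σ : (i : Fin k) → Sig i → AbelianGroup.Carrier G)
  → IsAbelianEmbedding G S σ → (i : Fin k) → Constant G (σ i)

-- If y ∈ S and y' ∈ S differ only in coordinate j, subtracting the two
-- embedding equations leaves σ_j (y j) = σ_j (y' j).  An edge of H_j(S) is
-- exactly such a pair, so σ_j is constant along paths of H_j(S), hence
-- constant when H_j(S) is connected.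
{-# OPTIONS --safe #-}
module Submission where

open import Defs
open import Level using (Level)
open import Data.Nat using (ℕ; zero; suc)
open import Data.Fin using (Fin; zero; suc; _≟_)
open import Data.Fin.Properties using (suc-injective)
open import Data.Product using (_×_; _,_)
open import Algebra.Bundles using (AbelianGroup)
open import Relation.Binary.PropositionalEquality using (_≡_; _≢_; refl; sym; trans; cong)
open import Relation.Nullary using (yes; no)
open import Data.Empty using (⊥-elim)
import Algebra.Properties.CommutativeSemigroup as CommutativeSemigroupProperties
import Relation.Binary.Reasoning.Setoid as SetoidReasoning

module _ {a} {k : ℕ} {Sig : Fin k → Set a} (y : Tuple Sig) (j : Fin k) (v : Sig j) where

  update-same : update y j v j ≡ v
  update-same with j ≟ j
  ... | yes refl = refl
  ... | no j≢j = ⊥-elim (j≢j refl)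

  update-other : ∀ i → j ≢ i → update y j v i ≡ y i
  update-other i j≢i with j ≟ i
  ... | yes refl = ⊥-elim (j≢i refl)
  ... | no _ = refl

module _ {c ℓ} (G : AbelianGroup c ℓ) where
  open AbelianGroup G renaming (Carrier to ∣G∣; refl to ≈-refl; sym to ≈-sym; trans to ≈-trans)
  open CommutativeSemigroupProperties commutativeSemigroup using (xy∙z≈zy∙x)
  open SetoidReasoning setoid

  ∑-cong : ∀ k {f g : Fin k → ∣G∣} → (∀ i → f i ≈ g i) → ∑ G k f ≈ ∑ G k g
  ∑-cong zero    f≈g = ≈-refl
  ∑-cong (suc k) f≈g = ∙-cong (f≈g zero) (∑-cong k (λ i → f≈g (suc i)))

  ∑-exchange : ∀ k (f g : Fin k → ∣G∣) (j : Fin k) → (∀ i → j ≢ i → f i ≈ g i)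
    → ∑ G k f ∙ g j ≈ ∑ G k g ∙ f j
  ∑-exchange (suc k) f g zero f≈g = begin
    (f zero ∙ ∑ G k (λ i → f (suc i))) ∙ g zero  ≈⟨ xy∙z≈zy∙x _ _ _ ⟩
    (g zero ∙ ∑ G k (λ i → f (suc i))) ∙ f zero  ≈⟨ ∙-congʳ (∙-congˡ (∑-cong k (λ i → f≈g (suc i) λ ()))) ⟩
    (g zero ∙ ∑ G k (λ i → g (suc i))) ∙ f zero  ∎
  ∑-exchange (suc k) f g (suc j) f≈g = begin
    (f zero ∙ ∑ G k (λ i → f (suc i))) ∙ g (suc j)  ≈⟨ assoc _ _ _ ⟩
    f zero ∙ (∑ G k (λ i → f (suc i)) ∙ g (suc j))  ≈⟨ ∙-cong (f≈g zero λ ()) tail-exchange ⟩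
    g zero ∙ (∑ G k (λ i → g (suc i)) ∙ f (suc j))  ≈⟨ ≈-sym (assoc _ _ _) ⟩
    (g zero ∙ ∑ G k (λ i → g (suc i))) ∙ f (suc j)  ∎
    where
    tail-exchange : ∑ G k (λ i → f (suc i)) ∙ g (suc j) ≈ ∑ G k (λ i → g (suc i)) ∙ f (suc j)
    tail-exchange = ∑-exchange k _ _ j (λ i j≢i → f≈g (suc i) (λ sj≡si → j≢i (suc-injective sj≡si)))

  module _ {a p} {k : ℕ} {Sig : Fin k → Set a} {S : Tuple Sig → Set p}
           {σ : (i : Fin k) → Sig i → ∣G∣} (embedding : IsAbelianEmbedding G S σ) where

    agree-off⇒σ-agree-at : ∀ {x x'} (j : Fin k) → S x → S x'
      → (∀ i → j ≢ i → x i ≡ x' i) → σ j (x j) ≈ σ j (x' j)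
    agree-off⇒σ-agree-at {x} {x'} j x∈S x'∈S x≡x' = begin
      σ j (x j)                                   ≈⟨ ≈-sym (identityˡ _) ⟩
      ε ∙ σ j (x j)                               ≈⟨ ∙-congʳ (≈-sym (embedding x' x'∈S)) ⟩
      ∑ G k (λ i → σ i (x' i)) ∙ σ j (x j)        ≈⟨ ≈-sym (∑-exchange k _ _ j σx≈σx') ⟩
      ∑ G k (λ i → σ i (x i)) ∙ σ j (x' j)        ≈⟨ ∙-congʳ (embedding x x∈S) ⟩
      ε ∙ σ j (x' j)                              ≈⟨ identityˡ _ ⟩
      σ j (x' j)                                  ∎
      where
      σx≈σx' : ∀ i → j ≢ i → σ i (x i) ≈ σ i (x' i)
      σx≈σx' i j≢i = reflexive (cong (σ i) (x≡x' i j≢i))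

    embedding-respects-Adj : ∀ j {v v'} → Adj S j v v' → σ j v ≈ σ j v'
    embedding-respects-Adj j {v} {v'} (_ , y , yv∈S , yv'∈S) = begin
      σ j v                    ≈⟨ reflexive (cong (σ j) (sym (update-same y j v))) ⟩
      σ j (update y j v j)     ≈⟨ agree-off⇒σ-agree-at j yv∈S yv'∈S agree ⟩
      σ j (update y j v' j)    ≈⟨ reflexive (cong (σ j) (update-same y j v')) ⟩
      σ j v'                   ∎
      where
      agree : ∀ i → j ≢ i → update y j v i ≡ update y j v' i
      agree i j≢i = trans (update-other y j v i j≢i) (sym (update-other y j v' i j≢i))

    embedding-constant-if-connectedWrt : ∀ j → ConnectedWrt S j → Constant G (σ j)
    embedding-constant-if-connectedWrt j connected v v' = along (connected v v')
      where
      along : ∀ {u u'} → Path (Adj S j) u u' → σ j u ≈ σ j u'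
      along here             = ≈-refl
      along (step edge path) = ≈-trans (embedding-respects-Adj j edge) (along path)

lemma4p9 : ∀ {a p c ℓ : Level} (k : ℕ) (Sig : Fin k → Set a)
    → ((i : Fin k) → Finite (Sig i))
    → (S : Tuple Sig → Set p)
    → ((G : AbelianGroup c ℓ) (σ : (i : Fin k) → Sig i → AbelianGroup.Carrier G)
        → IsAbelianEmbedding G S σ → (j : Fin k) → ConnectedWrt S j
        → Constant G (σ j))
      × (CoordinatewiseConnected S → NoAbelianEmbeddings c ℓ S)
lemma4p9 k Sig _ S =
  (λ G σ embedding → embedding-constant-if-connectedWrt G embedding) ,
  (λ connected G σ embedding j → embedding-constant-if-connectedWrt G embedding j (connected j))
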